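{- Let $\mathcal{A}$ be a warm start algorithm for instances in $\mathbf{I}$ with solutions in the metric space $(\mathbf{S}, d)$. Let $\mathbf{P} = (P_1, \dots, P_k)$ with $P_i \in \mathbf{S}$ be a set of $k$ predictions. Then for any instance $I \in \mathbf{I}$ with (unknown) true solution $S \in \mathbf{S}$, we can solve $I$ (i.e. output $S$) in time $O\big(k \cdot d(S, \mathbf{P}(S))\big)$, where $\mathbf{P}(S) = \arg\min_{P_j \in \mathbf{P}} d(S, P_j)$.
   Context: An instance space $\mathbf{I}$ and a solution space $\mathbf{S}$ are given; every instance $I\in\mathbf{I}$ has a true solution $S\in\mathbf{S}$. The solution space carries a metric $d$. A warm start algorithm $\mathcal{A}$ takes an instance $I\in\mathbf{I}$ and a predicted solution $P\in\mathbf{S}$ and outputs the true solution $S$ of $I$ in time at most $d(P,S)$. Standing assumption: distances are normalized so that the minimum distance in $\mathbf{S}$ is $1$ (two copies of the same point are treated as distinct points at positive distance), and $d(S_1,S_2)$ can be computed in $O(1)$ time for any $S_1,S_2\in\mathbf{S}$.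
   Formalization: The metric d on the solution space $\mathbf{S}$ takes values in the rationals. -}

module Defs where

open import Data.Nat using (ℕ; zero; suc)
open import Data.Fin using (Fin; zero; suc)
open import Data.Integer using (+_)
open import Data.Rational using (ℚ; _/_; _≤_; _+_; 1ℚ; _≤?_)
open import Data.Sum using (_⊎_; inj₁; inj₂)
open import Data.Product using (Σ; _×_; _,_)
open import Relation.Nullary using (yes; no)
open import Relation.Binary.PropositionalEquality using (_≡_)

ℕ→ℚ : ℕ → ℚ
ℕ→ℚ n = + n / 1

record IsNormalisedMetric {Sol : Set} (d : Sol → Sol → ℚ) : Set where
  field
    sym-d  : ∀ x y → d x y ≡ d y x
    tri-d  : ∀ x y z → d x z ≤ d x y + d y z
    min-d  : ∀ x y → 1ℚ ≤ d x y

-- An algorithm modelled as a step machine: a state space, an initial state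
-- built from the input (instance, predicted solution), and a one-time-unit
-- transition that either continues or halts with an output.
record Machine (Inst Sol : Set) : Set₁ where
  field
    State : Set
    init  : Inst → Sol → State
    step  : State → State ⊎ Sol

iterate : {St Sol : Set} → (St → St ⊎ Sol) → ℕ → St ⊎ Sol → St ⊎ Sol
iterate step zero    c        = c
iterate step (suc n) (inj₁ s) = iterate step n (step s)
iterate step (suc n) (inj₂ r) = inj₂ r

IsWarmStart : {Inst Sol : Set} → (sol : Inst → Sol) → (d : Sol → Sol → ℚ) →
              Machine Inst Sol → Set
IsWarmStart {Inst} {Sol} sol d A =
  ∀ (I : Inst) (P : Sol) → Σ ℕ λ t →
    (ℕ→ℚ t ≤ d P (sol I)) × (iterate (Machine.step A) t (inj₁ (Machine.init A I P)) ≡ inj₂ (sol I))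

argmin : {n : ℕ} → (Fin (suc n) → ℚ) → Fin (suc n)
argmin {zero}  f = zero
argmin {suc n} f with argmin {n} (λ j → f (suc j))
... | j with f zero ≤? f (suc j)
...   | yes _ = zero
...   | no  _ = suc j

closest : {k : ℕ} {Sol : Set} → (Sol → Sol → ℚ) → (Fin (suc k) → Sol) → Sol → Sol
closest d Ps S = Ps (argmin (λ j → d S (Ps j)))

-- Combined algorithm driven by a schedule σ : ℕ → Fin (suc k): at time step t it
-- advances (by one step of A) the copy of A started on prediction σ t; it halts
-- as soon as some copy has halted, with that copy's output.  One time step of
-- the combined algorithm = one step of A plus O(1) bookkeeping.
Config : (k : ℕ) → Set → Set → Set
Config k St Sol = (Fin (suc k) → St ⊎ Sol) ⊎ Sol

private
  update : {k : ℕ} {St Sol : Set} → (St → St ⊎ Sol) → Fin (suc k) →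
           (Fin (suc k) → St ⊎ Sol) → Config k St Sol
  update {k} step j cs with cs j
  ... | inj₂ r = inj₂ r
  ... | inj₁ s with step s
  ...   | inj₂ r  = inj₂ r
  ...   | inj₁ s' = inj₁ λ i → upd i
    where
      open import Data.Fin using (_≟_)
      upd : Fin (suc k) → _
      upd i with i ≟ j
      ... | yes _ = inj₁ s'
      ... | no  _ = cs i

runSchedule : {k : ℕ} {St Sol : Set} → (St → St ⊎ Sol) → (ℕ → Fin (suc k)) →
              ℕ → Config k St Sol → Config k St Sol
runSchedule step σ zero    c        = c
runSchedule step σ (suc t) (inj₂ r) = inj₂ r
runSchedule step σ (suc t) (inj₁ cs) = runSchedule step (λ n → σ (suc n)) t (update step (σ zero) cs)

startAll : {k : ℕ} {Inst Sol : Set} (A : Machine Inst Sol) → Inst →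
           (Fin (suc k) → Sol) → Config k (Machine.State A) Sol
startAll A I Ps = inj₁ λ j → inj₁ (Machine.init A I (Ps j))

module Submission where

-- Run one copy of the warm start algorithm per prediction and advance the copies in
-- round robin.  After t rounds every copy has made t steps, so the copy started on the
-- prediction P closest to S has halted once t ≥ d(P, S).  The combined machine stops at
-- the first copy to halt, and that copy outputs S too: each copy runs on the instance
-- whose solution is S, and a halting run from a given start has a unique output, which
-- the warm start guarantee pins down as S.  Hence S is output within (k+1)·d(S, P(S)) steps.

open import Defs
open import Data.Nat using (ℕ; zero; suc)
open import Data.Fin using (Fin; toℕ; _≟_)
open import Data.Rational using (ℚ; _≤_; _*_)
open import Data.Sum using (_⊎_; inj₁; inj₂)
open import Data.Product using (Σ; Σ-syntax; _×_; _,_)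
open import Relation.Binary.PropositionalEquality using (_≡_; refl; sym; trans; cong; cong₂; subst; subst₂; module ≡-Reasoning)

import Data.Nat as ℕ
import Data.Nat.Properties as ℕₚ
open import Data.Nat.DivMod using (_mod_; _%_; [m+kn]%n≡m%n; m<n⇒m%n≡m)
open import Data.Nat.Coprimality using (1-coprimeTo) renaming (sym to coprime-sym)
import Data.Fin.Properties as Finₚ
open import Data.Vec.Functional using (updateAt)
open import Data.Vec.Functional.Properties using (updateAt-updates; updateAt-minimal)
open import Relation.Nullary using (yes; no)
import Data.Integer as ℤ
import Data.Integer.Properties as ℤₚ
import Data.Rational as ℚ
import Data.Rational.Properties as ℚₚ

module _ {St Sol : Set} (step : St → St ⊎ Sol) where

  iterate-inj₂ : ∀ n r → iterate step n (inj₂ r) ≡ inj₂ r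
  iterate-inj₂ zero    r = refl
  iterate-inj₂ (suc n) r = refl

  iterate-+ : ∀ m n c → iterate step (m ℕ.+ n) c ≡ iterate step n (iterate step m c)
  iterate-+ zero    n c        = refl
  iterate-+ (suc m) n (inj₁ s) = iterate-+ m n (step s)
  iterate-+ (suc m) n (inj₂ r) = sym (iterate-inj₂ n r)

  iterate-suc : ∀ n c {s} → iterate step n c ≡ inj₁ s → iterate step (suc n) c ≡ step s
  iterate-suc n c {s} eq = begin
    iterate step (suc n) c              ≡⟨ cong (λ m → iterate step m c) (ℕₚ.+-comm 1 n) ⟩
    iterate step (n ℕ.+ 1) c            ≡⟨ iterate-+ n 1 c ⟩
    iterate step 1 (iterate step n c)   ≡⟨ cong (iterate step 1) eq ⟩
    step s                              ∎
    where open ≡-Reasoning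

  iterate-halted-≤ : ∀ {m n} c {r} → m ℕ.≤ n → iterate step m c ≡ inj₂ r → iterate step n c ≡ inj₂ r
  iterate-halted-≤ {m} {n} c {r} m≤n eq = begin
    iterate step n c                              ≡⟨ cong (λ l → iterate step l c) (sym (ℕₚ.m+[n∸m]≡n m≤n)) ⟩
    iterate step (m ℕ.+ (n ℕ.∸ m)) c              ≡⟨ iterate-+ m (n ℕ.∸ m) c ⟩
    iterate step (n ℕ.∸ m) (iterate step m c)     ≡⟨ cong (iterate step (n ℕ.∸ m)) eq ⟩
    iterate step (n ℕ.∸ m) (inj₂ r)               ≡⟨ iterate-inj₂ (n ℕ.∸ m) r ⟩
    inj₂ r                                        ∎
    where open ≡-Reasoning

  iterate-output-unique : ∀ m n c {r r′} → iterate step m c ≡ inj₂ r → iterate step n c ≡ inj₂ r′ → r ≡ r′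
  iterate-output-unique m n c eq eq′ with ℕₚ.≤-total m n
  ... | inj₁ m≤n with refl ← trans (sym (iterate-halted-≤ c m≤n eq)) eq′ = refl
  ... | inj₂ n≤m with refl ← trans (sym eq) (iterate-halted-≤ c n≤m eq′) = refl

warmStart-output : ∀ {Inst Sol} (sol : Inst → Sol) (d : Sol → Sol → ℚ) (A : Machine Inst Sol) →
                   IsWarmStart sol d A → ∀ I P n r →
                   iterate (Machine.step A) n (inj₁ (Machine.init A I P)) ≡ inj₂ r → r ≡ sol I
warmStart-output sol d A warm I P n r eq =
  let (t , _ , halts) = warm I P in iterate-output-unique (Machine.step A) n t (inj₁ (Machine.init A I P)) eq halts

module _ {k : ℕ} {St Sol : Set} (step : St → St ⊎ Sol) where

  runSchedule-inj₂ : ∀ σ t r → runSchedule {k} step σ t (inj₂ r) ≡ inj₂ r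
  runSchedule-inj₂ σ zero    r = refl
  runSchedule-inj₂ σ (suc t) r = refl

  runSchedule-+ : ∀ m n σ c → runSchedule {k} step σ (m ℕ.+ n) c ≡
                  runSchedule step (λ t → σ (m ℕ.+ t)) n (runSchedule step σ m c)
  runSchedule-+ zero    n σ c         = refl
  runSchedule-+ (suc m) n σ (inj₁ cs) = runSchedule-+ m n (λ t → σ (suc t)) _
  runSchedule-+ (suc m) n σ (inj₂ r)  = sym (runSchedule-inj₂ _ n r)

≤-updateAt-suc : ∀ {m} (n : Fin m → ℕ) j i → n i ℕ.≤ updateAt n j suc i
≤-updateAt-suc n j i with i ≟ j
... | yes refl = ℕₚ.≤-trans (ℕₚ.n≤1+n (n i)) (ℕₚ.≤-reflexive (sym (updateAt-updates i {suc} n)))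
... | no i≢j   = ℕₚ.≤-reflexive (sym (updateAt-minimal i j {suc} n i≢j))

module Simulation {k : ℕ} {St Sol : Set} (step : St → St ⊎ Sol)
                  (start : Fin (suc k) → St) (S : Sol)
                  (outputs-S : ∀ i n r → iterate step n (inj₁ (start i)) ≡ inj₂ r → r ≡ S) where

  SimulatesCopy : (Fin (suc k) → ℕ) → Config k St Sol → Fin (suc k) → Set
  SimulatesCopy n (inj₁ cs) i = Σ[ s ∈ St ] cs i ≡ inj₁ s × iterate step (n i) (inj₁ (start i)) ≡ inj₁ s
  SimulatesCopy n (inj₂ r)  i = r ≡ S

  Simulates : (Fin (suc k) → ℕ) → Config k St Sol → Set
  Simulates n c = ∀ i → SimulatesCopy n c i

  simulates-tick : ∀ σ n c → Simulates n c → Simulates (updateAt n (σ zero) suc) (runSchedule step σ 1 c)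
  simulates-tick σ n (inj₂ r)  sim i = sim i
  simulates-tick σ n (inj₁ cs) sim i with sim (σ zero)
  ... | s , cs-j≡s , iter-j≡s rewrite cs-j≡s with step s in step-s
  ...   | inj₂ r  = outputs-S (σ zero) (suc (n (σ zero))) r (trans (iterate-suc step (n (σ zero)) _ iter-j≡s) step-s)
  ...   | inj₁ s′ with i ≟ σ zero
  ...     | yes refl = s′ , refl , (begin
            iterate step (updateAt n i suc i) (inj₁ (start i))   ≡⟨ cong (λ m → iterate step m (inj₁ (start i))) (updateAt-updates i {suc} n) ⟩
            iterate step (suc (n i)) (inj₁ (start i))            ≡⟨ iterate-suc step (n i) _ iter-j≡s ⟩
            step s                                               ≡⟨ step-s ⟩
            inj₁ s′                                              ∎)
            where open ≡-Reasoning
  ...     | no i≢j rewrite updateAt-minimal i (σ zero) {suc} n i≢j = sim i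

  record Advanced (j : Fin (suc k)) (L : ℕ) (c : Config k St Sol) : Set where
    constructor advanced
    field
      steps     : Fin (suc k) → ℕ
      simulates : Simulates steps c
      L≤steps   : L ℕ.≤ steps j

  advanced-start : ∀ j → Advanced j 0 (inj₁ λ i → inj₁ (start i))
  advanced-start j = advanced (λ _ → 0) (λ i → start i , refl , refl) ℕ.z≤n

  advanced-tick : ∀ {j L c} σ → Advanced j L c → Advanced j L (runSchedule step σ 1 c)
  advanced-tick {j} {c = c} σ (advanced n sim L≤n) =
    advanced (updateAt n (σ zero) suc) (simulates-tick σ n c sim) (ℕₚ.≤-trans L≤n (≤-updateAt-suc n (σ zero) j))

  advanced-hit : ∀ {j L c} σ → σ zero ≡ j → Advanced j L c → Advanced j (suc L) (runSchedule step σ 1 c)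
  advanced-hit {c = c} σ refl (advanced n sim L≤n) =
    advanced (updateAt n (σ zero) suc) (simulates-tick σ n c sim)
    (ℕₚ.≤-trans (ℕ.s≤s L≤n) (ℕₚ.≤-reflexive (sym (updateAt-updates (σ zero) {suc} n))))

  advanced-run : ∀ {j L c} t σ → Advanced j L c → Advanced j L (runSchedule step σ t c)
  advanced-run zero    σ adv = adv
  advanced-run {j} {L} {c} (suc t) σ adv =
    subst (Advanced j L) (sym (runSchedule-+ step 1 t σ c))
          (advanced-run t (λ m → σ (suc m)) (advanced-tick σ adv))

  advanced-round : ∀ {j L c} σ → σ (toℕ j) ≡ j → Advanced j L c → Advanced j (suc L) (runSchedule step σ (suc k) c)
  advanced-round {j} {L} {c} σ hit adv =
    subst (Advanced j (suc L)) (sym run-split)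
      (advanced-run rest _ (advanced-hit σ′ σ′-hit (advanced-run (toℕ j) σ adv)))
    where
    rest : ℕ
    rest = k ℕ.∸ toℕ j
    σ′ : ℕ → Fin (suc k)
    σ′ t = σ (toℕ j ℕ.+ t)
    σ′-hit : σ′ zero ≡ j
    σ′-hit = trans (cong σ (ℕₚ.+-identityʳ (toℕ j))) hit
    length-split : suc k ≡ toℕ j ℕ.+ (1 ℕ.+ rest)
    length-split = sym (trans (ℕₚ.+-suc (toℕ j) rest) (cong suc (ℕₚ.m+[n∸m]≡n (Finₚ.toℕ≤pred[n] j))))
    run-split : runSchedule step σ (suc k) c ≡
                runSchedule step (λ t → σ′ (1 ℕ.+ t)) rest (runSchedule step σ′ 1 (runSchedule step σ (toℕ j) c))
    run-split = begin
      runSchedule step σ (suc k) c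
        ≡⟨ cong (λ t → runSchedule step σ t c) length-split ⟩
      runSchedule step σ (toℕ j ℕ.+ (1 ℕ.+ rest)) c
        ≡⟨ runSchedule-+ step (toℕ j) (1 ℕ.+ rest) σ c ⟩
      runSchedule step σ′ (1 ℕ.+ rest) (runSchedule step σ (toℕ j) c)
        ≡⟨ runSchedule-+ step 1 rest σ′ (runSchedule step σ (toℕ j) c) ⟩
      runSchedule step (λ t → σ′ (1 ℕ.+ t)) rest (runSchedule step σ′ 1 (runSchedule step σ (toℕ j) c)) ∎
      where open ≡-Reasoning

  advanced-rounds : ∀ {j L c} r σ → (∀ q → σ (q ℕ.* suc k ℕ.+ toℕ j) ≡ j) → Advanced j L c →
                    Advanced j (L ℕ.+ r) (runSchedule step σ (r ℕ.* suc k) c)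
  advanced-rounds {j} {L} zero σ visits adv = subst (λ l → Advanced j l _) (sym (ℕₚ.+-identityʳ L)) adv
  advanced-rounds {j} {L} {c} (suc r) σ visits adv =
    subst₂ (Advanced j) (sym (ℕₚ.+-suc L r)) (sym (runSchedule-+ step (suc k) (r ℕ.* suc k) σ c))
      (advanced-rounds r (λ t → σ (suc k ℕ.+ t)) visits′ (advanced-round σ (visits 0) adv))
    where
    visits′ : ∀ q → σ (suc k ℕ.+ (q ℕ.* suc k ℕ.+ toℕ j)) ≡ j
    visits′ q = trans (cong σ (sym (ℕₚ.+-assoc (suc k) (q ℕ.* suc k) (toℕ j)))) (visits (suc q))

  advanced-halted : ∀ {j L c r} → Advanced j L c → iterate step L (inj₁ (start j)) ≡ inj₂ r → c ≡ inj₂ S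
  advanced-halted {j} {c = inj₂ _}  (advanced _ sim _) _ = cong inj₂ (sim j)
  advanced-halted {j} {c = inj₁ _}  (advanced _ sim L≤n) halts with sim j
  ... | s , _ , iter-j≡s with () ← trans (sym iter-j≡s) (iterate-halted-≤ step _ L≤n halts)

roundRobin : (k : ℕ) → ℕ → Fin (suc k)
roundRobin k t = t mod suc k

roundRobin-visits : ∀ k (j : Fin (suc k)) q → roundRobin k (q ℕ.* suc k ℕ.+ toℕ j) ≡ j
roundRobin-visits k j q = Finₚ.toℕ-injective (begin
  toℕ (roundRobin k (q ℕ.* suc k ℕ.+ toℕ j))  ≡⟨ Finₚ.toℕ-fromℕ< _ ⟩
  (q ℕ.* suc k ℕ.+ toℕ j) % suc k              ≡⟨ cong (_% suc k) (ℕₚ.+-comm (q ℕ.* suc k) (toℕ j)) ⟩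
  (toℕ j ℕ.+ q ℕ.* suc k) % suc k              ≡⟨ [m+kn]%n≡m%n (toℕ j) q (suc k) ⟩
  toℕ j % suc k                                ≡⟨ m<n⇒m%n≡m (Finₚ.toℕ<n j) ⟩
  toℕ j                                        ∎)
  where open ≡-Reasoning

ℕ→ℚ-* : ∀ m n → ℕ→ℚ (m ℕ.* n) ≡ ℕ→ℚ m * ℕ→ℚ n
ℕ→ℚ-* m n = trans (cong (ℚ._/ 1) (ℤₚ.pos-* m n)) (sym (cong₂ _*_ (ℕ→ℚ-normal m) (ℕ→ℚ-normal n)))
  where
  -- once both factors are in normal form, their product computes to (m * n) / 1
  ℕ→ℚ-normal : ∀ n → ℕ→ℚ n ≡ ℚ.mkℚ (ℤ.+ n) 0 (coprime-sym (1-coprimeTo n))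
  ℕ→ℚ-normal n = ℚₚ.normalize-coprime (coprime-sym (1-coprimeTo n))

ℕ→ℚ-*-≤ : ∀ m n {p} → ℕ→ℚ m ≤ p → ℕ→ℚ (m ℕ.* n) ≤ ℕ→ℚ n * p
ℕ→ℚ-*-≤ m n {p} m≤p = begin
  ℕ→ℚ (m ℕ.* n)    ≡⟨ ℕ→ℚ-* m n ⟩
  ℕ→ℚ m * ℕ→ℚ n    ≤⟨ ℚₚ.*-monoʳ-≤-nonNeg (ℕ→ℚ n) {{ℚₚ.normalize-nonNeg n 1}} m≤p ⟩
  p * ℕ→ℚ n        ≡⟨ ℚₚ.*-comm p (ℕ→ℚ n) ⟩
  ℕ→ℚ n * p        ∎
  where open ℚₚ.≤-Reasoning

roundRobin-solves : ∀ {k Inst Sol} (d : Sol → Sol → ℚ) (sol : Inst → Sol) (A : Machine Inst Sol) →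
                    IsWarmStart sol d A → (Ps : Fin (suc k) → Sol) (I : Inst) (j : Fin (suc k)) →
                    Σ[ t ∈ ℕ ] ℕ→ℚ t ≤ ℕ→ℚ (suc k) * d (Ps j) (sol I) ×
                               runSchedule (Machine.step A) (roundRobin k) t (startAll A I Ps) ≡ inj₂ (sol I)
roundRobin-solves {k} d sol A warm Ps I j =
  let (t , t≤d , halts) = warm I (Ps j)
      open Simulation (Machine.step A) (λ i → Machine.init A I (Ps i)) (sol I) (λ i → warmStart-output sol d A warm I (Ps i))
  in t ℕ.* suc k , ℕ→ℚ-*-≤ t (suc k) t≤d ,
     advanced-halted (advanced-rounds t (roundRobin k) (roundRobin-visits k j) (advanced-start j)) halts

lemma3p1 : Σ ℕ λ c → (k : ℕ) → Σ (ℕ → Fin (suc k)) λ σ →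
    {Inst Sol : Set} (d : Sol → Sol → ℚ) → IsNormalisedMetric d →
    (sol : Inst → Sol) (A : Machine Inst Sol) → IsWarmStart sol d A →
    (Ps : Fin (suc k) → Sol) (I : Inst) →
    Σ ℕ λ t →
      (ℕ→ℚ t ≤ ℕ→ℚ c * ℕ→ℚ (suc k) * d (sol I) (closest d Ps (sol I))) ×
      (runSchedule (Machine.step A) σ t (startAll A I Ps) ≡ inj₂ (sol I))
lemma3p1 = 1 , λ k → roundRobin k , λ d metric sol A warm Ps I →
  let S = sol I
      j = argmin (λ i → d S (Ps i))
      (t , t≤d , solves) = roundRobin-solves d sol A warm Ps I j
      bound : ℕ→ℚ (suc k) * d (Ps j) S ≡ ℕ→ℚ 1 * ℕ→ℚ (suc k) * d S (closest d Ps S)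
      bound = trans (cong (ℕ→ℚ (suc k) *_) (IsNormalisedMetric.sym-d metric (Ps j) S))
                    (cong (_* d S (Ps j)) (sym (ℚₚ.*-identityˡ (ℕ→ℚ (suc k)))))
  in t , subst (ℕ→ℚ t ≤_) bound t≤d , solves
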